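{- Let $\alpha=\alpha_1\cdots\alpha_n$ and $\beta=\beta_1\cdots\beta_n$ be two words of positive integers on which the SR algorithm does not terminate. If $\mathrm{shape}(R(\alpha))=\mathrm{shape}(R(\beta))$, then $s_{\alpha_1}s_{\alpha_2}\cdots s_{\alpha_n}=s_{\beta_1}s_{\beta_2}\cdots s_{\beta_n}$ as permutations.
   Context: $s_i$ denotes the adjacent transposition $(i,i+1)$ of the positive integers. A cell is a pair $(i,j)$ of integers with $i\ge 1$, $j\ge 0$. A tower diagram is a finite set $\mathcal T$ of cells such that $(i,j)\in\mathcal T$ and $0\le k\le j$ imply $(i,k)\in\mathcal T$. The cell $(i,j)$ lies on the diagonal $x+y=i+j$. Sliding: for a positive integer $\alpha$, $\alpha^{\searrow}\mathcal T$ is computed by the procedure $P(\gamma,m)$ started at $\gamma=\alpha$, $m=1$: (S1) if no cell $(i,j)\in\mathcal T$ with $i\ge m$ lies on $x+y=\gamma-1$: (a) if $(\gamma,0)\notin\mathcal T$ the result is $\mathcal T\cup\{(\gamma,0)\}$; (b) if $(\gamma,0)\in\mathcal T$, $(\gamma,1)\notin\mathcal T$ the slide terminates (without result); (c) if $(\gamma,0),(\gamma,1)\in\mathcal T$, continue with $P(\gamma+1,\gamma+1)$. (S2) Otherwise let $i\ge m$ be smallest with $(i,\gamma-1-i)\in\mathcal T$: (a) if $(i,\gamma-i)\notin\mathcal T$ the result is $\mathcal T\cup\{(i,\gamma-i)\}$; (b) if $(i,\gamma-i)\in\mathcal T$, $(i,\gamma-i+1)\notin\mathcal T$ the slide terminates;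 (c) if both are in $\mathcal T$, continue with $P(\gamma+1,i+1)$. SR algorithm: for a word $\alpha=\alpha_1\cdots\alpha_n$, set $\mathcal T^{(0)}=\varnothing$, $\mathcal T^{(k)}=\alpha_k^{\searrow}\mathcal T^{(k-1)}$; if some slide terminates, the algorithm terminates. Otherwise $\mathcal T^{(k)}=\mathcal T^{(k-1)}\cup\{d_k\}$, the recording tableau $R(\alpha)$ labels $d_k$ by $k$, and $\mathrm{shape}(R(\alpha))=\mathcal T^{(n)}$. -}

module Defs where

open import Data.Nat using (ℕ; zero; suc; _≤_; _<_; _∸_; _≟_)
open import Data.Product using (_×_; _,_)
open import Data.List using (List; []; _∷_; _++_; [_]; foldr; map)
open import Data.List.Membership.Propositional using (_∈_; _∉_)
open import Data.Maybe using (Maybe; just; nothing)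
open import Relation.Nullary using (¬_; yes; no)

-- A cell (i , j); a (finite) diagram is given by a list of cells, read as a set
-- (membership via _∈_; order and repetitions are irrelevant).
Cell : Set
Cell = ℕ × ℕ

Diagram : Set
Diagram = List Cell

OnDiag : Diagram → ℕ → ℕ → ℕ → Set
OnDiag T m d i = (m ≤ i) × (i ≤ d) × ((i , d ∸ i) ∈ T)

NoDiag : Diagram → ℕ → ℕ → Set
NoDiag T m d = ∀ i → ¬ OnDiag T m d i

SmallestOnDiag : Diagram → ℕ → ℕ → ℕ → Set
SmallestOnDiag T m d i = OnDiag T m d i × (∀ k → k < i → ¬ OnDiag T m d k)

-- The procedure P(γ, m) on T, as a (deterministic) relation to its outcome:
-- just c  : the result is T ∪ {c};   nothing : the slide terminates.
data Slide (T : Diagram) : ℕ → ℕ → Maybe Cell → Set where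
  s1a : ∀ {γ m} → NoDiag T m (γ ∸ 1) → (γ , 0) ∉ T →
        Slide T γ m (just (γ , 0))
  s1b : ∀ {γ m} → NoDiag T m (γ ∸ 1) → (γ , 0) ∈ T → (γ , 1) ∉ T →
        Slide T γ m nothing
  s1c : ∀ {γ m r} → NoDiag T m (γ ∸ 1) → (γ , 0) ∈ T → (γ , 1) ∈ T →
        Slide T (suc γ) (suc γ) r → Slide T γ m r
  s2a : ∀ {γ m i} → SmallestOnDiag T m (γ ∸ 1) i → (i , γ ∸ i) ∉ T →
        Slide T γ m (just (i , γ ∸ i))
  s2b : ∀ {γ m i} → SmallestOnDiag T m (γ ∸ 1) i → (i , γ ∸ i) ∈ T →
        (i , suc (γ ∸ i)) ∉ T → Slide T γ m nothing
  s2c : ∀ {γ m i r} → SmallestOnDiag T m (γ ∸ 1) i → (i , γ ∸ i) ∈ T →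
        (i , suc (γ ∸ i)) ∈ T → Slide T (suc γ) (suc i) r → Slide T γ m r

SlideInto : ℕ → Diagram → Cell → Set
SlideInto a T d = Slide T a 1 (just d)

-- SRRun w T : the SR algorithm on the word w does not terminate and
-- T^(n) = shape(R(w)) is (the set of cells of) T.
data SRRun : List ℕ → Diagram → Set where
  sr-nil  : SRRun [] []
  sr-snoc : ∀ {w T a d} → SRRun w T → SlideInto a T d → SRRun (w ++ [ a ]) (d ∷ T)

SameCells : Diagram → Diagram → Set
SameCells T U = ∀ c → (c ∈ T → c ∈ U) × (c ∈ U → c ∈ T)

s : ℕ → ℕ → ℕ
s i k with k ≟ i
... | yes _ = suc i
... | no _ with k ≟ suc i
...   | yes _ = i
...   | no _ = k

perm : List ℕ → ℕ → ℕ
perm w = foldr (λ (f g : ℕ → ℕ) → λ k → f (g k)) (λ k → k) (map s w)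

-- Reading a tower diagram column by column, the cell (i , j) stands for the
-- transposition s_{i+j} of its diagonal, so column i reads s_i s_{i+1} ⋯ s_{i+h_i−1}.
-- Invariant of the SR algorithm: the word inserted so far and the reading word of
-- the current tower give the same permutation. Inserting α appends s_α on the
-- right; this letter commutes past the columns lying below the diagonal searched
-- by the slide, becomes s_{γ+1} by a braid move whenever the slide passes on to
-- the next diagonal (the cases (c)), and is absorbed on top of the column that
-- receives the new cell. So the permutation depends only on the column heights,
-- that is, on the shape.
module Submission where

open import Defs
open import Data.Nat using (ℕ; zero; suc; _+_; _∸_; _≤_; _<_; _≮_; _≟_; z≤n; s≤s)
open import Data.Nat.Properties
open import Data.Product using (_×_; _,_; proj₁; proj₂)
open import Data.Sum using (inj₁; inj₂)
open import Data.Empty using (⊥-elim)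
open import Data.Maybe using (just)
open import Data.List using (List; []; _∷_; _++_; [_]; length)
open import Data.List.Membership.Propositional using (_∈_; _∉_)
open import Data.List.Relation.Unary.Any using (here; there)
open import Data.List.Relation.Unary.All using (All; []; _∷_)
open import Data.List.Relation.Unary.All.Properties using (++⁻)
open import Function using (_∘_)
open import Function.Bundles using (mk⇔; Equivalence; _⇔_)
open import Relation.Nullary using (¬_; yes; no)
open import Relation.Binary.PropositionalEquality hiding ([_])

s-moves-i : ∀ i → s i i ≡ suc i
s-moves-i i with i ≟ i
... | yes _ = refl
... | no i≢i = ⊥-elim (i≢i refl)

s-moves-1+i : ∀ i → s i (suc i) ≡ i
s-moves-1+i i with suc i ≟ i
... | yes 1+i≡i = ⊥-elim (>⇒≢ ≤-refl 1+i≡i)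
... | no _ with suc i ≟ suc i
...   | yes _ = refl
...   | no 1+i≢1+i = ⊥-elim (1+i≢1+i refl)

s-fixes : ∀ i k → k ≢ i → k ≢ suc i → s i k ≡ k
s-fixes i k k≢i k≢1+i with k ≟ i
... | yes k≡i = ⊥-elim (k≢i k≡i)
... | no _ with k ≟ suc i
...   | yes k≡1+i = ⊥-elim (k≢1+i k≡1+i)
...   | no _ = refl

data Position (i k : ℕ) : Set where
  at-i      : k ≡ i → Position i k
  at-1+i    : k ≡ suc i → Position i k
  elsewhere : k ≢ i → k ≢ suc i → Position i k

position : ∀ i k → Position i k
position i k with k ≟ i
... | yes k≡i = at-i k≡i
... | no k≢i with k ≟ suc i
...   | yes k≡1+i = at-1+i k≡1+i
...   | no k≢1+i = elsewhere k≢i k≢1+i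

s-fixes-< : ∀ {i k} → k < i → s i k ≡ k
s-fixes-< k<i = s-fixes _ _ (<⇒≢ k<i) (<⇒≢ (m<n⇒m<1+n k<i))

s-fixes-> : ∀ {i k} → suc i < k → s i k ≡ k
s-fixes-> 1+i<k = s-fixes _ _ (>⇒≢ (<-trans (n<1+n _) 1+i<k)) (>⇒≢ 1+i<k)

s-comm-far : ∀ a b → suc a < b → ∀ k → s a (s b k) ≡ s b (s a k)
s-comm-far a b 1+a<b = commute
  where
  a<b : a < b
  a<b = <-trans (n<1+n a) 1+a<b
  commute : ∀ k → s a (s b k) ≡ s b (s a k)
  commute k with position a k | position b k
  ... | at-i refl | _
    rewrite s-fixes-< a<b | s-moves-i a | s-fixes-< 1+a<b = refl
  ... | at-1+i refl | _
    rewrite s-fixes-< 1+a<b | s-moves-1+i a | s-fixes-< a<b = refl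
  ... | elsewhere k≢a k≢1+a | at-i refl
    rewrite s-fixes a b k≢a k≢1+a | s-moves-i b | s-fixes-> (s≤s a<b) = refl
  ... | elsewhere k≢a k≢1+a | at-1+i refl
    rewrite s-fixes a (suc b) k≢a k≢1+a | s-moves-1+i b | s-fixes-> 1+a<b = refl
  ... | elsewhere k≢a k≢1+a | elsewhere k≢b k≢1+b
    rewrite s-fixes a k k≢a k≢1+a | s-fixes b k k≢b k≢1+b | s-fixes a k k≢a k≢1+a = refl

s-braid : ∀ a k → s a (s (suc a) (s a k)) ≡ s (suc a) (s a (s (suc a) k))
s-braid a k with position a k
... | at-i refl
  rewrite s-moves-i a | s-moves-i (suc a) | s-fixes-< (n<1+n a) | s-moves-i a
        | s-fixes-> (n<1+n (suc a)) | s-moves-i (suc a) = refl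
... | at-1+i refl
  rewrite s-moves-1+i a | s-fixes-< (n<1+n a) | s-moves-i a | s-moves-i (suc a)
        | s-fixes-> (n<1+n (suc a)) | s-moves-1+i (suc a) = refl
... | elsewhere k≢a k≢1+a with position (suc a) k
...   | at-i k≡1+a = ⊥-elim (k≢1+a k≡1+a)
...   | at-1+i refl
  rewrite s-fixes-> (n<1+n (suc a)) | s-moves-1+i (suc a) | s-moves-1+i a | s-fixes-< (n<1+n a) = refl
...   | elsewhere _ k≢2+a
  rewrite s-fixes a k k≢a k≢1+a | s-fixes (suc a) k k≢1+a k≢2+a
        | s-fixes a k k≢a k≢1+a | s-fixes (suc a) k k≢1+a k≢2+a = refl

column : ℕ → ℕ → ℕ → ℕ
column j zero    n = n
column j (suc l) n = s j (column (suc j) l n)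

column-comm-below : ∀ j l γ → j + l < γ → ∀ n → column j l (s γ n) ≡ s γ (column j l n)
column-comm-below j zero    γ _     n = refl
column-comm-below j (suc l) γ j+l<γ n = begin
    s j (column (suc j) l (s γ n))
  ≡⟨ cong (s j) (column-comm-below (suc j) l γ 1+j+l<γ n) ⟩
    s j (s γ (column (suc j) l n))
  ≡⟨ s-comm-far j γ (≤-<-trans (s≤s (m≤m+n j l)) 1+j+l<γ) (column (suc j) l n) ⟩
    s γ (s j (column (suc j) l n))
  ∎
  where
  open ≡-Reasoning
  1+j+l<γ : suc j + l < γ
  1+j+l<γ = subst (_< γ) (+-suc j l) j+l<γ

column-comm-above : ∀ j l γ → suc γ < j → ∀ n → column j l (s γ n) ≡ s γ (column j l n)
column-comm-above j zero    γ _     n = refl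
column-comm-above j (suc l) γ 1+γ<j n =
  trans (cong (s j) (column-comm-above (suc j) l γ (m<n⇒m<1+n 1+γ<j) n))
        (sym (s-comm-far γ j 1+γ<j (column (suc j) l n)))

column-extend : ∀ j l n → column j l (s (j + l) n) ≡ column j (suc l) n
column-extend j zero    n rewrite +-identityʳ j = refl
column-extend j (suc l) n rewrite +-suc j l = cong (s j) (column-extend (suc j) l n)

column-shift : ∀ j l γ → j ≤ γ → suc γ < j + l → ∀ n → column j l (s γ n) ≡ s (suc γ) (column j l n)
column-shift j zero γ j≤γ 1+γ<j+0 n =
  ⊥-elim (<⇒≱ 1+γ<j+0 (m≤n⇒m≤1+n (subst (_≤ γ) (sym (+-identityʳ j)) j≤γ)))
column-shift j (suc l) γ j≤γ 1+γ<j+1+l n with m≤n⇒m<n∨m≡n j≤γ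
... | inj₁ j<γ =
  trans (cong (s j) (column-shift (suc j) l γ j<γ (subst (suc γ <_) (+-suc j l) 1+γ<j+1+l) n))
        (s-comm-far j (suc γ) (s≤s j<γ) (column (suc j) l n))
column-shift j (suc zero) j j≤j 1+j<j+1 n | inj₂ refl =
  ⊥-elim (<-irrefl (sym (+-comm j 1)) 1+j<j+1)
column-shift j (suc (suc l)) j j≤j _ n | inj₂ refl =
  trans (cong (λ m → s j (s (suc j) m)) (column-comm-above (suc (suc j)) l j ≤-refl n))
        (s-braid j (column (suc (suc j)) l n))

Heights : Diagram → (ℕ → ℕ) → Set
Heights T h = ∀ i j → (i , j) ∈ T ⇔ j < h i

module _ {T : Diagram} {h : ℕ → ℕ} (hs : Heights T h) where

  height-> : ∀ {i j} → (i , j) ∈ T → j < h i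
  height-> {i} {j} = Equivalence.to (hs i j)

  height-≤ : ∀ {i j} → (i , j) ∉ T → h i ≤ j
  height-≤ {i} {j} ∉T = ≮⇒≥ (λ j<h → ∉T (Equivalence.from (hs i j) j<h))

  height-≡ : ∀ {i j} → (i , j) ∈ T → (i , suc j) ∉ T → h i ≡ suc j
  height-≡ ∈T 1+j∉T = ≤-antisym (height-≤ 1+j∉T) (height-> ∈T)

module _ {T : Diagram} {h : ℕ → ℕ} (hs : Heights T h) {i d : ℕ} (i≤d : i ≤ d) where

  below-diagonal : (i , d ∸ i) ∉ T → i + h i ≤ d
  below-diagonal ∉T = subst (i + h i ≤_) (m+[n∸m]≡n i≤d) (+-monoʳ-≤ i (height-≤ hs ∉T))

  above-diagonal : (i , d ∸ i) ∈ T → d < i + h i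
  above-diagonal ∈T = subst (_< i + h i) (m+[n∸m]≡n i≤d) (+-monoʳ-< i (height-> hs ∈T))

heights-unique : ∀ {T U h h′} → Heights T h → Heights U h′ → SameCells T U → ∀ i → h i ≡ h′ i
heights-unique {h = h} {h′} hs hs′ T≈U i = ≤-antisym (≮⇒≥ h′<h) (≮⇒≥ h<h′)
  where
  h′<h : h′ i ≮ h i
  h′<h h′<h = <-irrefl refl (height-> hs′ (proj₁ (T≈U _) (Equivalence.from (hs i _) h′<h)))
  h<h′ : h i ≮ h′ i
  h<h′ h<h′ = <-irrefl refl (height-> hs (proj₂ (T≈U _) (Equivalence.from (hs′ i _) h<h′)))

bump : (ℕ → ℕ) → ℕ → ℕ → ℕ
bump h c i with i ≟ c
... | yes _ = suc (h i)
... | no _  = h i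

bump-same : ∀ h c → bump h c c ≡ suc (h c)
bump-same h c with c ≟ c
... | yes _   = refl
... | no c≢c = ⊥-elim (c≢c refl)

bump-other : ∀ h c i → i ≢ c → bump h c i ≡ h i
bump-other h c i i≢c with i ≟ c
... | yes i≡c = ⊥-elim (i≢c i≡c)
... | no _    = refl

heights-∷ : ∀ {T h c x} → Heights T h → x ≡ h c → Heights ((c , x) ∷ T) (bump h c)
heights-∷ {T} {h} {c} {x} hs x≡hc i j with i ≟ c
... | no i≢c = mk⇔ to (there ∘ Equivalence.from (hs i j))
  where
  to : (i , j) ∈ (c , x) ∷ T → j < h i
  to (here refl) = ⊥-elim (i≢c refl)
  to (there ∈T)  = height-> hs ∈T
... | yes refl = mk⇔ to from
  where
  to : (i , j) ∈ (i , x) ∷ T → j < suc (h i)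
  to (here refl) = s≤s (≤-reflexive x≡hc)
  to (there ∈T)  = m<n⇒m<1+n (height-> hs ∈T)
  from : j < suc (h i) → (i , j) ∈ (i , x) ∷ T
  from j<1+h with m≤n⇒m<n∨m≡n (≤-pred j<1+h)
  ... | inj₁ j<h  = there (Equivalence.from (hs i j) j<h)
  ... | inj₂ refl = here (cong (i ,_) (sym x≡hc))

-- reading h m k = column (m+k−1) ∘ ⋯ ∘ column m, with heights h; column m acts
-- first, so it is the rightmost factor of the reading word.
reading : (ℕ → ℕ) → ℕ → ℕ → ℕ → ℕ
reading h m zero    n = n
reading h m (suc k) n = reading h (suc m) k (column m (h m) n)

reading-cong : ∀ {h h′} m k → (∀ j → m ≤ j → h j ≡ h′ j) → ∀ n → reading h m k n ≡ reading h′ m k n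
reading-cong m zero    h≗h′ n = refl
reading-cong m (suc k) h≗h′ n rewrite h≗h′ m ≤-refl =
  reading-cong (suc m) k (λ j m<j → h≗h′ j (<⇒≤ m<j)) _

reading-trivial : ∀ h m k → (∀ j → m ≤ j → h j ≡ 0) → ∀ n → reading h m k n ≡ n
reading-trivial h m zero    h≗0 n = refl
reading-trivial h m (suc k) h≗0 n rewrite h≗0 m ≤-refl =
  reading-trivial h (suc m) k (λ j m<j → h≗0 j (<⇒≤ m<j)) n

reading-pad : ∀ h m k e → (∀ j → m + k ≤ j → h j ≡ 0) → ∀ n → reading h m (k + e) n ≡ reading h m k n
reading-pad h m zero    e h≗0 n =
  reading-trivial h m e (λ j m≤j → h≗0 j (subst (_≤ j) (sym (+-identityʳ m)) m≤j)) n
reading-pad h m (suc k) e h≗0 n =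
  reading-pad h (suc m) k e (λ j le → h≗0 j (subst (_≤ j) (sym (+-suc m k)) le)) _

-- Appending s_γ to the reading word of the columns from m on has the effect of
-- adding a cell on top of column c.
Absorbs : (ℕ → ℕ) → ℕ → ℕ → ℕ → Set
Absorbs h γ m c = ∀ k → c < m + k → ∀ n → reading h m k (s γ n) ≡ reading (bump h c) m k n

reading-bump-head : ∀ h c t k n → t ≢ c →
  reading (bump h c) (suc t) k (column t (h t) n) ≡ reading (bump h c) t (suc k) n
reading-bump-head h c t k n t≢c =
  cong (λ l → reading (bump h c) (suc t) k (column t l n)) (sym (bump-other h c t t≢c))

absorb-here : ∀ h t γ → t + h t ≡ γ → Absorbs h γ t t
absorb-here h t _ refl zero    t<t+0 n = ⊥-elim (<-irrefl (sym (+-identityʳ t)) t<t+0)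
absorb-here h t _ refl (suc k) _     n = begin
    reading h (suc t) k (column t (h t) (s (t + h t) n))
  ≡⟨ cong (reading h (suc t) k) (column-extend t (h t) n) ⟩
    reading h (suc t) k (column t (suc (h t)) n)
  ≡⟨ reading-cong (suc t) k (λ j t<j → sym (bump-other h t j (>⇒≢ t<j))) _ ⟩
    reading (bump h t) (suc t) k (column t (suc (h t)) n)
  ≡⟨ cong (λ l → reading (bump h t) (suc t) k (column t l n)) (sym (bump-same h t)) ⟩
    reading (bump h t) t (suc k) n
  ∎
  where open ≡-Reasoning

absorb-shift : ∀ h t γ c → t ≤ γ → suc γ < t + h t → t < c →
  Absorbs h (suc γ) (suc t) c → Absorbs h γ t c
absorb-shift h t γ c _ _ t<c _ zero c<t+0 n =
  ⊥-elim (<-asym t<c (subst (c <_) (+-identityʳ t) c<t+0))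
absorb-shift h t γ c t≤γ 1+γ<t+h[t] t<c absorbs (suc k) c<t+1+k n = begin
    reading h (suc t) k (column t (h t) (s γ n))
  ≡⟨ cong (reading h (suc t) k) (column-shift t (h t) γ t≤γ 1+γ<t+h[t] n) ⟩
    reading h (suc t) k (s (suc γ) (column t (h t) n))
  ≡⟨ absorbs k (subst (c <_) (+-suc t k) c<t+1+k) _ ⟩
    reading (bump h c) (suc t) k (column t (h t) n)
  ≡⟨ reading-bump-head h c t k n (<⇒≢ t<c) ⟩
    reading (bump h c) t (suc k) n
  ∎
  where open ≡-Reasoning

absorb-pass : ∀ h γ m t c → m ≤ t → t ≤ c → (∀ j → m ≤ j → j < t → j + h j < γ) →
  Absorbs h γ t c → Absorbs h γ m c
absorb-pass h γ m t c m≤t t≤c below absorbs k c<m+k n with m≤n⇒m<n∨m≡n m≤t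
... | inj₂ refl = absorbs k c<m+k n
absorb-pass h γ m t c m≤t t≤c below absorbs zero c<m+0 n | inj₁ m<t =
  ⊥-elim (<-asym (<-≤-trans m<t t≤c) (subst (c <_) (+-identityʳ m) c<m+0))
absorb-pass h γ m t c m≤t t≤c below absorbs (suc k) c<m+1+k n | inj₁ m<t = begin
    reading h (suc m) k (column m (h m) (s γ n))
  ≡⟨ cong (reading h (suc m) k) (column-comm-below m (h m) γ (below m ≤-refl m<t) n) ⟩
    reading h (suc m) k (s γ (column m (h m) n))
  ≡⟨ absorb-pass h γ (suc m) t c m<t t≤c (λ j m<j → below j (<⇒≤ m<j)) absorbs
       k (subst (c <_) (+-suc m k) c<m+1+k) _ ⟩
    reading (bump h c) (suc m) k (column m (h m) n)
  ≡⟨ reading-bump-head h c m k n (<⇒≢ (<-≤-trans m<t t≤c)) ⟩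
    reading (bump h c) m (suc k) n
  ∎
  where open ≡-Reasoning

module _ {T : Diagram} {h : ℕ → ℕ} (hs : Heights T h) where

  off-diagonal : ∀ {m g j} → m ≤ j → j ≤ g → ¬ OnDiag T m g j → j + h j < suc g
  off-diagonal m≤j j≤g ¬on = s≤s (below-diagonal hs j≤g (λ ∈T → ¬on (m≤j , j≤g , ∈T)))

  slide-absorbs : ∀ {g m c x} → Slide T (suc g) m (just (c , x)) → m ≤ suc g →
    x ≡ h c × m ≤ c × Absorbs h (suc g) m c
  slide-absorbs {g} {m} (s1a none ∉T) m≤1+g =
    sym h[1+g]≡0 , m≤1+g ,
    absorb-pass h (suc g) m (suc g) (suc g) m≤1+g ≤-refl
      (λ j m≤j j≤g → off-diagonal m≤j (≤-pred j≤g) (none j))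
      (absorb-here h (suc g) (suc g) (trans (cong (suc g +_) h[1+g]≡0) (+-identityʳ (suc g))))
    where
    h[1+g]≡0 : h (suc g) ≡ 0
    h[1+g]≡0 = n≤0⇒n≡0 (height-≤ hs ∉T)
  slide-absorbs {g} {m} {c} (s1c none _ ∈T rest) m≤1+g with slide-absorbs rest ≤-refl
  ... | x≡hc , 1+g<c , absorbs =
    x≡hc , ≤-trans m≤1+g (<⇒≤ 1+g<c) ,
    absorb-pass h (suc g) m (suc g) c m≤1+g (<⇒≤ 1+g<c)
      (λ j m≤j j≤g → off-diagonal m≤j (≤-pred j≤g) (none j))
      (absorb-shift h (suc g) (suc g) c ≤-refl
        (above-diagonal hs (n≤1+n (suc g)) (subst (λ j → (suc g , j) ∈ T) (sym (m+n∸n≡m 1 g)) ∈T))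
        1+g<c absorbs)
  slide-absorbs {g} {m} (s2a {i = i} ((m≤i , i≤g , ∈T) , smaller) ∉T) _ =
    trans (+-∸-assoc 1 i≤g) (sym h[i]≡1+g∸i) , m≤i ,
    absorb-pass h (suc g) m i i m≤i ≤-refl
      (λ j m≤j j<i → off-diagonal m≤j (≤-trans (<⇒≤ j<i) i≤g) (smaller j j<i))
      (absorb-here h i (suc g) i+h[i]≡1+g)
    where
    h[i]≡1+g∸i : h i ≡ suc (g ∸ i)
    h[i]≡1+g∸i = height-≡ hs ∈T (subst (λ j → (i , j) ∉ T) (+-∸-assoc 1 i≤g) ∉T)
    i+h[i]≡1+g : i + h i ≡ suc g
    i+h[i]≡1+g = trans (cong (i +_) h[i]≡1+g∸i) (trans (+-suc i (g ∸ i)) (cong suc (m+[n∸m]≡n i≤g)))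
  slide-absorbs {g} {m} {c} (s2c {i = i} ((m≤i , i≤g , _) , smaller) _ ∈T rest) _
    with slide-absorbs rest (s≤s (m≤n⇒m≤1+n i≤g))
  ... | x≡hc , i<c , absorbs =
    x≡hc , ≤-trans m≤i (<⇒≤ i<c) ,
    absorb-pass h (suc g) m i c m≤i (<⇒≤ i<c)
      (λ j m≤j j<i → off-diagonal m≤j (≤-trans (<⇒≤ j<i) i≤g) (smaller j j<i))
      (absorb-shift h i (suc g) c i≤1+g
        (above-diagonal hs (m≤n⇒m≤1+n i≤1+g) (subst (λ j → (i , j) ∈ T) (sym (+-∸-assoc 1 i≤1+g)) ∈T))
        i<c absorbs)
    where
    i≤1+g : i ≤ suc g
    i≤1+g = m≤n⇒m≤1+n i≤g

perm-snoc : ∀ w a k → perm (w ++ [ a ]) k ≡ perm w (s a k)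
perm-snoc []      a k = refl
perm-snoc (b ∷ w) a k = cong (s b) (perm-snoc w a k)

record ReadingOf (w : List ℕ) (T : Diagram) : Set where
  field
    height        : ℕ → ℕ
    width         : ℕ
    heights       : Heights T height
    height-beyond : ∀ i → width < i → height i ≡ 0
    perm≡reading  : ∀ k → perm w k ≡ reading height 1 width k

readingOf-snoc : ∀ {w T a d} → ReadingOf w T → 1 ≤ a → SlideInto a T d → ReadingOf (w ++ [ a ]) (d ∷ T)
readingOf-snoc {w} {_} {suc g} {c , x} R _ slide with slide-absorbs (ReadingOf.heights R) slide (s≤s z≤n)
... | x≡hc , _ , absorbs = record
  { height        = bump height c
  ; width         = width + c
  ; heights       = heights-∷ heights x≡hc
  ; height-beyond = λ i w+c<i →
      trans (bump-other height c i (>⇒≢ (≤-<-trans (m≤n+m c width) w+c<i)))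
            (height-beyond i (≤-<-trans (m≤m+n width c) w+c<i))
  ; perm≡reading  = λ k → begin
      perm (w ++ [ suc g ]) k                     ≡⟨ perm-snoc w (suc g) k ⟩
      perm w (s (suc g) k)                        ≡⟨ perm≡reading _ ⟩
      reading height 1 width (s (suc g) k)        ≡⟨ sym (reading-pad height 1 width c height-beyond _) ⟩
      reading height 1 (width + c) (s (suc g) k)  ≡⟨ absorbs (width + c) (s≤s (m≤n+m c width)) k ⟩
      reading (bump height c) 1 (width + c) k     ∎
  }
  where
  open ReadingOf R
  open ≡-Reasoning

readingOf : ∀ {w T} → SRRun w T → All (1 ≤_) w → ReadingOf w T
readingOf sr-nil _ = record
  { height        = λ _ → 0
  ; width         = 0
  ; heights       = λ _ _ → mk⇔ (λ ()) (λ ())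
  ; height-beyond = λ _ _ → refl
  ; perm≡reading  = λ _ → refl
  }
readingOf (sr-snoc {w} run slide) 1≤w+a with ++⁻ w 1≤w+a
... | 1≤w , 1≤a ∷ [] = readingOf-snoc (readingOf run 1≤w) 1≤a slide

perm-determined : ∀ {w v T U} → ReadingOf w T → ReadingOf v U → SameCells T U → ∀ k → perm w k ≡ perm v k
perm-determined {w} {v} R R′ T≈U k = begin
  perm w k                   ≡⟨ perm≡reading R k ⟩
  reading h 1 N k            ≡⟨ sym (reading-pad h 1 N N′ (height-beyond R) k) ⟩
  reading h 1 (N + N′) k     ≡⟨ reading-cong 1 (N + N′) (λ i _ → h≗h′ i) k ⟩
  reading h′ 1 (N + N′) k    ≡⟨ cong (λ M → reading h′ 1 M k) (+-comm N N′) ⟩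
  reading h′ 1 (N′ + N) k    ≡⟨ reading-pad h′ 1 N′ N (height-beyond R′) k ⟩
  reading h′ 1 N′ k          ≡⟨ sym (perm≡reading R′ k) ⟩
  perm v k                   ∎
  where
  open ReadingOf
  open ≡-Reasoning
  h h′ : ℕ → ℕ
  h  = height R
  h′ = height R′
  N N′ : ℕ
  N  = width R
  N′ = width R′
  h≗h′ : ∀ i → h i ≡ h′ i
  h≗h′ = heights-unique (heights R) (heights R′) T≈U

theorem4p2 : (α β : List ℕ) → All (1 ≤_) α → All (1 ≤_) β →
    length α ≡ length β →
    (T U : Diagram) → SRRun α T → SRRun β U → SameCells T U →
    ∀ k → perm α k ≡ perm β k
theorem4p2 α β 1≤α 1≤β _ T U runα runβ T≈U =
  perm-determined (readingOf runα 1≤α) (readingOf runβ 1≤β) T≈U
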